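{- Let $P$ be a dendritic face complex and $x\in P$ with $\dim x\ge1$. Then the following data form a rooted tree: the set of nodes is $\delta(x)$; the arity of a node $y$ is $A(y)=\delta(y)$; for $y,y'\in\delta(x)$ and $z\in\delta(y)$ there is a triplet $y\xrightarrow{z}y'$ iff $z=\gamma(y')$ (i.e. $z\prec^-y\prec^-x$ and $z\prec^+y'\prec^-x$); the root is the unique element of $\delta(x)$ if $\dim x=1$, and if $\dim x\ge2$ it is the unique element $\rho(x)\in\delta(x)$ with $\gamma(\rho(x))=\gamma(\gamma(x))$ (such an element exists and is unique).
   Context: A positive-to-one poset (POP) is a finite set $P$ with $\dim:P\to\mathbb{N}$ and binary relations $\prec^-,\prec^+$; $y\prec x$ means $y\prec^-x$ or $y\prec^+x$. Axioms: $y\prec x\Rightarrow\dim x=\dim y+1$; never both $y\prec^-x$ and $y\prec^+x$; every $x$ with $\dim x\ge1$ has exactly one $y$ with $y\prec^+x$, denoted $\gamma(x)$, and at least one $y$ with $y\prec^-x$. $\delta(x)=\{y:y\prec^-x\}$; $\le$ is the reflexive-transitive closure of $\prec$. A dendritic face complex is a POP such that: $(P,\le)$ has a greatest element; (oriented thinness) whenever $z\prec^{\beta}y\prec^{\alpha}x$ there is a unique $y'\ne y$ with $z\prec y'\prec x$, and writing $z\prec^{\beta'}y'\prec^{\alpha'}x$ the signs (as $\pm1$) satisfy $\alpha\beta=-\alpha'\beta'$; (acyclicity) $\delta(x)$ is a singleton if $\dim x=1$, nonempty if $\dim x\ge1$, and for $\dim x\ge1$ there are no $p\ge1$, $y_1,\dots,y_p\in\delta(x)$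 with $\gamma(y_{i+1})\in\delta(y_i)$ ($1\le i<p$) and $\gamma(y_1)\in\delta(y_p)$. A rooted tree $T$ consists of a finite set of nodes $T^\bullet$, for each node $a$ a finite set $A(a)$ (its arity), and a set of triplets $a\xrightarrow{b}a'$ with $a,a'\in T^\bullet$, $b\in A(a)$, such that for each $a$ and $b\in A(a)$ there is at most one triplet $a\xrightarrow{b}a'$; together with a node $\rho(T)$, the root, such that for every node $a$ there is a unique descending path to the root, i.e. a unique sequence $a=a_0,a_1,\dots,a_p=\rho(T)$ and $b_1,\dots,b_p$ with a triplet $a_i\xrightarrow{b_i}a_{i-1}$ for each $1\le i\le p$. -}

module Defs where

open import Data.Nat using (ℕ; zero; suc; _≤_)
open import Data.Fin using (Fin; zero; suc; inject₁; fromℕ)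
open import Data.Bool using (Bool; T)
open import Data.Product using (Σ; _×_; _,_; proj₁)
open import Data.Sum using (_⊎_)
open import Data.List using (List; []; _∷_)
open import Relation.Nullary using (¬_)
open import Relation.Binary.PropositionalEquality using (_≡_; _≢_)
open import Relation.Binary.Construct.Closure.ReflexiveTransitive using (Star)
open import Function.Bundles using (_↔_)

data Sgn : Set where
  minus plus : Sgn

_·_ : Sgn → Sgn → Sgn
minus · minus = plus
minus · plus  = minus
plus  · minus = minus
plus  · plus  = plus

flipS : Sgn → Sgn
flipS minus = plus
flipS plus  = minus

record PreOG : Set where
  field
    n    : ℕ
    dim  : Fin n → ℕ
    negR : Fin n → Fin n → Bool   -- negR y x  ↔  y ≺⁻ x
    posR : Fin n → Fin n → Bool   -- posR y x  ↔  y ≺⁺ x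

module Notation (P : PreOG) where
  open PreOG P public

  _≺⁻_ : Fin n → Fin n → Set
  y ≺⁻ x = T (negR y x)

  _≺⁺_ : Fin n → Fin n → Set
  y ≺⁺ x = T (posR y x)

  _≺_ : Fin n → Fin n → Set
  y ≺ x = (y ≺⁻ x) ⊎ (y ≺⁺ x)

  _≺[_]_ : Fin n → Sgn → Fin n → Set
  y ≺[ minus ] x = y ≺⁻ x
  y ≺[ plus  ] x = y ≺⁺ x

  _≤P_ : Fin n → Fin n → Set
  y ≤P x = Star _≺_ y x

  -- Link y y'  means  γ(y') ∈ δ(y), i.e. there is z with z ≺⁺ y' and z ≺⁻ y
  -- (γ(y') is the unique such ≺⁺-face of y').
  Link : Fin n → Fin n → Set
  Link y y' = Σ (Fin n) λ z → (z ≺⁺ y') × (z ≺⁻ y)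

record IsPOP (P : PreOG) : Set where
  open Notation P
  field
    dim-≺      : ∀ {x y} → y ≺ x → dim x ≡ suc (dim y)
    disjoint   : ∀ {x y} → ¬ ((y ≺⁻ x) × (y ≺⁺ x))
    γ-unique   : ∀ x → 1 ≤ dim x →
                   Σ (Fin n) λ y → (y ≺⁺ x) × (∀ y' → y' ≺⁺ x → y' ≡ y)
    δ-nonempty : ∀ x → 1 ≤ dim x → Σ (Fin n) λ y → y ≺⁻ x

record IsDFC (P : PreOG) : Set where
  open Notation P
  field
    isPOP     : IsPOP P
    greatest  : Σ (Fin n) λ top → ∀ y → y ≤P top
    thin      : ∀ {x y z α β} → z ≺[ β ] y → y ≺[ α ] x →
                  Σ (Fin n) λ y' →
                    (y' ≢ y)
                  × ((z ≺ y') × (y' ≺ x))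
                  × (∀ y'' → y'' ≢ y → z ≺ y'' → y'' ≺ x → y'' ≡ y')
                  × (∀ α' β' → z ≺[ β' ] y' → y' ≺[ α' ] x →
                       (α' · β') ≡ flipS (α · β))
    δ-single  : ∀ x → dim x ≡ 1 →
                  Σ (Fin n) λ y → (y ≺⁻ x) × (∀ y' → y' ≺⁻ x → y' ≡ y)
    -- (nonemptiness of δ(x) for dim x ≥ 1 is already part of IsPOP)
    noCycle   : ∀ x → 1 ≤ dim x → ∀ k (ys : Fin (suc k) → Fin n) →
                  (∀ i → ys i ≺⁻ x) →
                  (∀ (i : Fin k) → Link (ys (inject₁ i)) (ys (suc i))) →
                  ¬ Link (ys (fromℕ k)) (ys zero)

Finite : Set → Set
Finite X = Σ ℕ λ m → X ↔ Fin m

-- A descending path from a to the root, as the data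
-- [(a₁,b₁), …, (a_p,b_p)] (with a₀ = a), valid when there is a triplet
-- aᵢ —bᵢ→ aᵢ₋₁ for each i and a_p is the root.
module _ {Node : Set} (A : Node → Set)
         (Tri : (a : Node) → A a → Node → Set) (root : Node) where

  ValidDesc : Node → List (Σ Node A) → Set
  ValidDesc a []               = a ≡ root
  ValidDesc a ((a₁ , b₁) ∷ ps) = Tri a₁ b₁ a × ValidDesc a₁ ps

record IsRootedTree (Node : Set) (A : Node → Set)
                    (Tri : (a : Node) → A a → Node → Set)
                    (root : Node) : Set where
  field
    nodes-finite : Finite Node
    arity-finite : ∀ a → Finite (A a)
    tri-atMostOne : ∀ {a b a' a''} → Tri a b a' → Tri a b a'' → a' ≡ a''
    uniquePath   : ∀ a → Σ (List (Σ Node A)) λ ps →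
                     ValidDesc A Tri root a ps
                     × (∀ qs → ValidDesc A Tri root a qs → qs ≡ ps)

module _ (P : PreOG) (x : Fin (PreOG.n P)) where
  open Notation P

  TNode : Set
  TNode = Σ (Fin n) λ y → y ≺⁻ x

  TArity : TNode → Set
  TArity (y , _) = Σ (Fin n) λ z → z ≺⁻ y

  TTri : (a : TNode) → TArity a → TNode → Set
  TTri _ (z , _) (y' , _) = z ≺⁺ y'

  -- γ(r) = γ(γ(x)), expressed via the (unique) ≺⁺-faces
  GammaCond : Fin n → Set
  GammaCond r = Σ (Fin n) λ w → Σ (Fin n) λ v →
                  (w ≺⁺ x) × (v ≺⁺ w) × (v ≺⁺ r)

{-# OPTIONS --safe #-}
module Submission where

-- For y ∈ δ(x) with dim x ≥ 2, oriented thinness applied to γ(y) ≺⁺ y ≺⁻ x yields one other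
-- face y₁ of x through γ(y), and exactly one of the two signs flips: either γ(y) ≺⁻ y₁ ≺⁻ x,
-- so y₁ is the parent of y (γ(y) is an input of y₁), or γ(y) ≺⁺ y₁ ≺⁺ x, so y₁ = γ(x) and
-- γ(y) = γ(γ(x)), i.e. y is the root; applied to γ(γ(x)) ≺⁺ γ(x) ≺⁺ x, the same argument
-- produces the root. The uniqueness clause of thinness makes triplets and parents unique
-- and the root an orphan. The acyclicity axiom says that the parent relation has no cycles,
-- hence it is well-founded on the finite set δ(x), and climbing parents reaches the root
-- along the unique descending path. If dim x = 1, δ(x) is a singleton whose element has
-- no inputs.

open import Defs
open import Data.Nat using (ℕ; zero; suc; _≤_; _+_; z≤n; s≤s; s≤s⁻¹)
open import Data.Nat.Properties using (≤-trans; suc-injective; 0≢1+n)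
open import Data.Fin using (Fin; zero; suc; inject₁; fromℕ)
open import Data.Fin.Properties using (0↔⊥; 1↔⊤; +↔⊎)
open import Data.Fin.Induction using (spo-wellFounded)
open import Data.Bool using (true; false; T)
open import Data.Bool.Properties using (T-irrelevant)
open import Data.Product using (Σ; _×_; _,_; proj₁; proj₂)
open import Data.Sum using (_⊎_; inj₁; inj₂)
open import Data.Sum.Function.Propositional using (_⊎-↔_)
open import Data.List using (List; []; _∷_)
import Data.Vec.Functional as Vector
open import Function using (_∘_)
open import Function.Bundles using (_↔_; mk↔ₛ′)
open import Function.Properties.Inverse using (↔-sym; ↔-trans)
open import Induction.WellFounded using (WellFounded; Acc; acc; module Subrelation)
open import Level using (0ℓ)
open import Relation.Binary using (Rel; IsStrictPartialOrder)
open import Relation.Binary.Construct.Closure.Transitive using (TransClosure; [_]; _∷_; _++_; wellFounded⁻)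
import Relation.Binary.Construct.On as On
open import Data.Empty using (⊥-elim)
open import Relation.Nullary using (¬_)
open import Relation.Binary.PropositionalEquality
  using (_≡_; _≢_; refl; sym; subst; isEquivalence; resp₂; ≢-sym; cong; trans)

Finite-↔ : {A B : Set} → A ↔ B → Finite B → Finite A
Finite-↔ A↔B (m , B↔Fin) = m , ↔-trans A↔B B↔Fin

Finite-⊎ : {A B : Set} → Finite A → Finite B → Finite (A ⊎ B)
Finite-⊎ (m , A↔) (k , B↔) = m + k , ↔-trans (A↔ ⊎-↔ B↔) (↔-sym +↔⊎)

Finite-T : ∀ b → Finite (T b)
Finite-T false = 0 , ↔-sym 0↔⊥
Finite-T true  = 1 , ↔-sym 1↔⊤

Σ-Fin-suc↔ : ∀ {m} {P : Fin (suc m) → Set} → Σ (Fin (suc m)) P ↔ (P zero ⊎ Σ (Fin m) (P ∘ suc))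
Σ-Fin-suc↔ {m} {P} = mk↔ₛ′ to from (λ { (inj₁ _) → refl ; (inj₂ _) → refl })
                           (λ { (zero , _) → refl ; (suc _ , _) → refl })
  where
  to : Σ (Fin (suc m)) P → P zero ⊎ Σ (Fin m) (P ∘ suc)
  to (zero , p)  = inj₁ p
  to (suc i , p) = inj₂ (i , p)
  from : P zero ⊎ Σ (Fin m) (P ∘ suc) → Σ (Fin (suc m)) P
  from (inj₁ p)       = zero , p
  from (inj₂ (i , p)) = suc i , p

Finite-Σ-Fin : ∀ m {P : Fin m → Set} → (∀ i → Finite (P i)) → Finite (Σ (Fin m) P)
Finite-Σ-Fin zero    _      = 0 , mk↔ₛ′ (λ { (() , _) }) (λ ()) (λ ()) (λ { (() , _) })
Finite-Σ-Fin (suc m) finite =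
  Finite-↔ Σ-Fin-suc↔ (Finite-⊎ (finite zero) (Finite-Σ-Fin m (finite ∘ suc)))

acyclic⇒wellFounded : ∀ {m ℓ} {_⊏_ : Rel (Fin m) ℓ} →
                      (∀ {i} → ¬ TransClosure _⊏_ i i) → WellFounded _⊏_
acyclic⇒wellFounded {_⊏_ = _⊏_} acyclic = wellFounded⁻ _⊏_ (spo-wellFounded ⊏⁺-isStrictPartialOrder)
  where
  ⊏⁺-isStrictPartialOrder : IsStrictPartialOrder _≡_ (TransClosure _⊏_)
  ⊏⁺-isStrictPartialOrder = record
    { isEquivalence = isEquivalence
    ; irrefl        = λ { refl → acyclic }
    ; trans         = _++_
    ; <-resp-≈      = resp₂ (TransClosure _⊏_)
    }

module Descent {Node : Set} (A : Node → Set) (Tri : (a : Node) → A a → Node → Set) where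

  Parent : Rel Node 0ℓ
  Parent a₁ a = Σ (A a₁) λ b → Tri a₁ b a

  module _ (root : Node) where

    Path : Node → Set
    Path a = Σ (List (Σ Node A)) (ValidDesc A Tri root a)

    path-unique : (∀ {a a₁ a₁′ b b′} → Tri a₁ b a → Tri a₁′ b′ a →
                     _≡_ {A = Σ Node A} (a₁ , b) (a₁′ , b′)) →
                  (∀ a₁ b → ¬ Tri a₁ b root) →
                  ∀ {a} ps qs → ValidDesc A Tri root a ps → ValidDesc A Tri root a qs → qs ≡ ps
    path-unique parent-unique root-orphan = go
      where
      go : ∀ {a} ps qs → ValidDesc A Tri root a ps → ValidDesc A Tri root a qs → qs ≡ ps
      go []             []             _        _         = refl
      go []             ((a₁ , b) ∷ _) refl     (t , _)   = ⊥-elim (root-orphan a₁ b t)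
      go ((a₁ , b) ∷ _) []             (t , _)  refl      = ⊥-elim (root-orphan a₁ b t)
      go (p ∷ ps)       (q ∷ qs)       (t , vp) (t′ , vq) with parent-unique t′ t
      ... | refl = cong (p ∷_) (go ps qs vp vq)

    path-exists : (∀ a → Σ Node (λ a₁ → Parent a₁ a) ⊎ a ≡ root) → WellFounded Parent →
                  ∀ a → Path a
    path-exists parent-or-root wf a = go (wf a)
      where
      go : ∀ {a} → Acc Parent a → Path a
      go {a} (acc rs) with parent-or-root a
      ... | inj₂ a≡root            = [] , a≡root
      ... | inj₁ (a₁ , b , a₁→a) with go (rs (b , a₁→a))
      ...   | ps , valid = (a₁ , b) ∷ ps , a₁→a , valid

flip-one-sign : ∀ α β α′ β′ → α′ · β′ ≡ flipS (α · β) →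
                (α′ ≡ flipS α × β′ ≡ β) ⊎ (α′ ≡ α × β′ ≡ flipS β)
flip-one-sign minus minus minus minus ()
flip-one-sign minus minus minus plus  refl = inj₂ (refl , refl)
flip-one-sign minus minus plus  minus refl = inj₁ (refl , refl)
flip-one-sign minus minus plus  plus  ()
flip-one-sign minus plus  minus minus refl = inj₂ (refl , refl)
flip-one-sign minus plus  minus plus  ()
flip-one-sign minus plus  plus  minus ()
flip-one-sign minus plus  plus  plus  refl = inj₁ (refl , refl)
flip-one-sign plus  minus minus minus refl = inj₁ (refl , refl)
flip-one-sign plus  minus minus plus  ()
flip-one-sign plus  minus plus  minus ()
flip-one-sign plus  minus plus  plus  refl = inj₂ (refl , refl)
flip-one-sign plus  plus  minus minus ()
flip-one-sign plus  plus  minus plus  refl = inj₁ (refl , refl)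
flip-one-sign plus  plus  plus  minus refl = inj₂ (refl , refl)
flip-one-sign plus  plus  plus  plus  ()

module DendriticFaceComplex {P : PreOG} (D : IsDFC P) where
  open Notation P
  open IsDFC D
  open IsPOP isPOP

  ≺-signed : ∀ {x y} → y ≺ x → Σ Sgn λ α → y ≺[ α ] x
  ≺-signed (inj₁ y≺⁻x) = minus , y≺⁻x
  ≺-signed (inj₂ y≺⁺x) = plus , y≺⁺x

  γ-≡ : ∀ {x z z′} → z ≺⁺ x → z′ ≺⁺ x → z ≡ z′
  γ-≡ {x} z≺⁺x z′≺⁺x with γ-unique x (subst (1 ≤_) (sym (dim-≺ (inj₂ z≺⁺x))) (s≤s z≤n))
  ... | _ , _ , unique = trans (unique _ z≺⁺x) (sym (unique _ z′≺⁺x))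

  face-sign-≢ : ∀ {x y y′} → y ≺⁻ x → y′ ≺⁺ x → y ≢ y′
  face-sign-≢ y≺⁻x y′≺⁺x refl = disjoint (y≺⁻x , y′≺⁺x)

  coface-sign-≢ : ∀ {z y y′} → z ≺⁻ y → z ≺⁺ y′ → y ≢ y′
  coface-sign-≢ z≺⁻y z≺⁺y′ refl = disjoint (z≺⁻y , z≺⁺y′)

  face-dim-pos : ∀ {x y} → 2 ≤ dim x → y ≺ x → 1 ≤ dim y
  face-dim-pos 2≤dim y≺x = s≤s⁻¹ (subst (2 ≤_) (dim-≺ y≺x) 2≤dim)

  thin-≡ : ∀ {x y z α β y₁ y₂} → z ≺[ β ] y → y ≺[ α ] x →
           y₁ ≢ y → z ≺ y₁ → y₁ ≺ x → y₂ ≢ y → z ≺ y₂ → y₂ ≺ x → y₁ ≡ y₂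
  thin-≡ {α = α} {β} z≺y y≺x y₁≢y z≺y₁ y₁≺x y₂≢y z≺y₂ y₂≺x with thin {α = α} {β} z≺y y≺x
  ... | _ , _ , _ , unique , _ = trans (unique _ y₁≢y z≺y₁ y₁≺x) (sym (unique _ y₂≢y z≺y₂ y₂≺x))

  thin-flip : ∀ {x y z α β} → z ≺[ β ] y → y ≺[ α ] x →
              Σ (Fin n) λ y′ → y′ ≢ y ×
                ((z ≺[ β ] y′ × y′ ≺[ flipS α ] x) ⊎ (z ≺[ flipS β ] y′ × y′ ≺[ α ] x))
  thin-flip {α = α} {β} z≺y y≺x with thin {α = α} {β} z≺y y≺x
  ... | y′ , y′≢y , (z≺y′ , y′≺x) , _ , signs with ≺-signed z≺y′ | ≺-signed y′≺x
  ... | β′ , z≺[β′]y′ | α′ , y′≺[α′]x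
        with flip-one-sign α β α′ β′ (signs α′ β′ z≺[β′]y′ y′≺[α′]x)
  ... | inj₁ (refl , refl) = y′ , y′≢y , inj₁ (z≺[β′]y′ , y′≺[α′]x)
  ... | inj₂ (refl , refl) = y′ , y′≢y , inj₂ (z≺[β′]y′ , y′≺[α′]x)

  module _ (x : Fin n) where
    open Descent (TArity P x) (TTri P x)

    Node : Set
    Node = TNode P x

    node-≡ : {a a′ : Node} → proj₁ a ≡ proj₁ a′ → a ≡ a′
    node-≡ {_ , p} {_ , p′} refl = cong (_ ,_) (T-irrelevant p p′)

    input-≡ : ∀ {y y′ z z′} {p p′} {q : z ≺⁻ y} {q′ : z′ ≺⁻ y′} → y ≡ y′ → z ≡ z′ →
              _≡_ {A = Σ Node (TArity P x)} ((y , p) , (z , q)) ((y′ , p′) , (z′ , q′))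
    input-≡ {p = p} {p′} {q} {q′} refl refl
      rewrite T-irrelevant p p′ | T-irrelevant q q′ = refl

    triplet-functional : ∀ {a b a′ a″} → TTri P x a b a′ → TTri P x a b a″ → a′ ≡ a″
    triplet-functional {_ , y≺⁻x} {_ , z≺⁻y} {_ , y′≺⁻x} {_ , y″≺⁻x} z≺⁺y′ z≺⁺y″ =
      node-≡ (thin-≡ {α = minus} {minus} z≺⁻y y≺⁻x
                (≢-sym (coface-sign-≢ z≺⁻y z≺⁺y′)) (inj₂ z≺⁺y′) (inj₁ y′≺⁻x)
                (≢-sym (coface-sign-≢ z≺⁻y z≺⁺y″)) (inj₂ z≺⁺y″) (inj₁ y″≺⁻x))

    parent-unique : ∀ {a a₁ a₁′ b b′} → TTri P x a₁ b a → TTri P x a₁′ b′ a →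
                    _≡_ {A = Σ Node (TArity P x)} (a₁ , b) (a₁′ , b′)
    parent-unique {_ , y≺⁻x} {_ , y₁≺⁻x} {_ , y₁′≺⁻x} {_ , z≺⁻y₁} {_ , z′≺⁻y₁′} z≺⁺y z′≺⁺y
      with γ-≡ z≺⁺y z′≺⁺y
    ... | refl = input-≡ (thin-≡ {α = minus} {plus} z≺⁺y y≺⁻x
                            (coface-sign-≢ z≺⁻y₁ z≺⁺y) (inj₁ z≺⁻y₁) (inj₁ y₁≺⁻x)
                            (coface-sign-≢ z′≺⁻y₁′ z≺⁺y) (inj₁ z′≺⁻y₁′) (inj₁ y₁′≺⁻x)) refl

    _⊏_ : Rel (Fin n) 0ℓ
    y′ ⊏ y = y′ ≺⁻ x × Link y′ y

    record LinkedSequence (a b : Fin n) : Set where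
      field
        len         : ℕ
        seq         : Fin (suc len) → Fin n
        head        : seq zero ≡ a
        inside      : ∀ i → seq i ≺⁻ x
        linked      : ∀ (i : Fin len) → Link (seq (inject₁ i)) (seq (suc i))
        last-linked : Link (seq (fromℕ len)) b

    linkedSequence : ∀ {a b} → TransClosure _⊏_ a b → LinkedSequence a b
    linkedSequence {a} [ a≺⁻x , a→b ] = record
      { len = 0 ; seq = λ _ → a ; head = refl ; inside = λ _ → a≺⁻x
      ; linked = λ () ; last-linked = a→b }
    linkedSequence {a} ((a≺⁻x , a→c) ∷ c⊏⁺b) = record
      { len         = suc len
      ; seq         = a Vector.∷ seq
      ; head        = refl
      ; inside      = λ { zero → a≺⁻x ; (suc i) → inside i }
      ; linked      = λ { zero → subst (Link a) (sym head) a→c ; (suc i) → linked i }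
      ; last-linked = last-linked
      }
      where open LinkedSequence (linkedSequence c⊏⁺b)

    ⊏-wellFounded : 1 ≤ dim x → WellFounded _⊏_
    ⊏-wellFounded 1≤dim = acyclic⇒wellFounded λ a⊏⁺a →
      let open LinkedSequence (linkedSequence a⊏⁺a) in
      noCycle x 1≤dim len seq inside linked (subst (Link _) (sym head) last-linked)

    parent-wellFounded : 1 ≤ dim x → WellFounded Parent
    parent-wellFounded 1≤dim =
      Subrelation.wellFounded (λ { {_ , y₁≺⁻x} ((z , z≺⁻y₁) , z≺⁺y) → y₁≺⁻x , z , z≺⁺y , z≺⁻y₁ })
        (On.wellFounded proj₁ (⊏-wellFounded 1≤dim))

    isRootedTree : 1 ≤ dim x → (r : Node) → (∀ a₁ b → ¬ TTri P x a₁ b r) →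
                   (∀ a → Σ Node (λ a₁ → Parent a₁ a) ⊎ a ≡ r) →
                   IsRootedTree Node (TArity P x) (TTri P x) r
    -- TTri ignores its first node and is stuck on the others, so implicit nodes must be passed on by hand.
    isRootedTree 1≤dim r root-orphan parent-or-root = record
      { nodes-finite  = Finite-Σ-Fin n (λ y → Finite-T (negR y x))
      ; arity-finite  = λ { (y , _) → Finite-Σ-Fin n (λ z → Finite-T (negR z y)) }
      ; tri-atMostOne = λ {a} {b} {a′} {a″} → triplet-functional {a} {b} {a′} {a″}
      ; uniquePath    = λ a →
          let (ps , valid) = path-exists r parent-or-root (parent-wellFounded 1≤dim) a in
          ps , valid , λ qs →
            path-unique r (λ {a} {a₁} {a₁′} {b} {b′} → parent-unique {a} {a₁} {a₁′} {b} {b′})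
                        root-orphan ps qs valid
      }

    dim≡1⇒no-inputs : dim x ≡ 1 → ∀ a → ¬ TArity P x a
    dim≡1⇒no-inputs dim≡1 (y , y≺⁻x) (z , z≺⁻y) =
      0≢1+n (trans (suc-injective (trans (sym dim≡1) (dim-≺ (inj₁ y≺⁻x)))) (dim-≺ (inj₁ z≺⁻y)))

    dim≡1⇒node-unique : dim x ≡ 1 → (a a′ : Node) → a ≡ a′
    dim≡1⇒node-unique dim≡1 (_ , y≺⁻x) (_ , y′≺⁻x) with δ-single x dim≡1
    ... | _ , _ , unique = node-≡ (trans (unique _ y≺⁻x) (sym (unique _ y′≺⁻x)))

    γγ-root-unique : ∀ {a b} → GammaCond P x a → a ≺⁻ x → GammaCond P x b → b ≺⁻ x → a ≡ b
    γγ-root-unique (w , v , w≺⁺x , v≺⁺w , v≺⁺a) a≺⁻x (_ , _ , w′≺⁺x , v′≺⁺w′ , v′≺⁺b) b≺⁻x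
      with γ-≡ w≺⁺x w′≺⁺x
    ... | refl with γ-≡ v≺⁺w v′≺⁺w′
    ... | refl = thin-≡ {α = plus} {plus} v≺⁺w w≺⁺x
                   (face-sign-≢ a≺⁻x w≺⁺x) (inj₂ v≺⁺a) (inj₁ a≺⁻x)
                   (face-sign-≢ b≺⁻x w≺⁺x) (inj₂ v′≺⁺b) (inj₁ b≺⁻x)

    γγ-root-exists : 2 ≤ dim x → Σ Node λ r → GammaCond P x (proj₁ r)
    γγ-root-exists 2≤dim with γ-unique x (≤-trans (s≤s z≤n) 2≤dim)
    ... | w , w≺⁺x , _ with γ-unique w (face-dim-pos 2≤dim (inj₂ w≺⁺x))
    ... | v , v≺⁺w , _ with thin-flip {α = plus} {plus} v≺⁺w w≺⁺x
    ... | r , _   , inj₁ (v≺⁺r , r≺⁻x) = (r , r≺⁻x) , w , v , w≺⁺x , v≺⁺w , v≺⁺r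
    ... | r , r≢w , inj₂ (_ , r≺⁺x)    = ⊥-elim (r≢w (γ-≡ r≺⁺x w≺⁺x))

    γγ-root-orphan : ∀ r → GammaCond P x (proj₁ r) → ∀ a₁ b → ¬ TTri P x a₁ b r
    γγ-root-orphan (_ , r≺⁻x) (w , v , w≺⁺x , v≺⁺w , v≺⁺r) (_ , y₁≺⁻x) (_ , z≺⁻y₁) z≺⁺r
      with γ-≡ z≺⁺r v≺⁺r
    ... | refl = coface-sign-≢ z≺⁻y₁ z≺⁺r
                   (thin-≡ {α = plus} {plus} v≺⁺w w≺⁺x
                     (face-sign-≢ y₁≺⁻x w≺⁺x) (inj₁ z≺⁻y₁) (inj₁ y₁≺⁻x)
                     (face-sign-≢ r≺⁻x w≺⁺x) (inj₂ z≺⁺r) (inj₁ r≺⁻x))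

    parent-or-γγ-root : 2 ≤ dim x → ∀ r → GammaCond P x (proj₁ r) →
                        ∀ a → Σ Node (λ a₁ → Parent a₁ a) ⊎ a ≡ r
    parent-or-γγ-root 2≤dim (_ , r≺⁻x) r-root (y , y≺⁻x)
      with γ-unique y (face-dim-pos 2≤dim (inj₁ y≺⁻x))
    ... | z , z≺⁺y , _ with thin-flip {α = minus} {plus} z≺⁺y y≺⁻x
    ... | y₁ , _ , inj₁ (z≺⁺y₁ , y₁≺⁺x) =
      inj₂ (node-≡ (γγ-root-unique (y₁ , z , y₁≺⁺x , z≺⁺y₁ , z≺⁺y) y≺⁻x r-root r≺⁻x))
    ... | y₁ , _ , inj₂ (z≺⁻y₁ , y₁≺⁻x) = inj₁ ((y₁ , y₁≺⁻x) , (z , z≺⁻y₁) , z≺⁺y)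

    γγ-root : 2 ≤ dim x → Σ Node λ r → GammaCond P x (proj₁ r)
                × (∀ r′ → GammaCond P x (proj₁ r′) → r′ ≡ r)
    γγ-root 2≤dim with γγ-root-exists 2≤dim
    ... | r , r-root = r , r-root , λ r′ r′-root →
            node-≡ (γγ-root-unique r′-root (proj₂ r′) r-root (proj₂ r))

mainTheorem4 : (P : PreOG) → IsDFC P → (x : Fin (PreOG.n P)) →
    1 ≤ PreOG.dim P x →
    ((PreOG.dim P x ≡ 1) →
      ∀ (r : TNode P x) → IsRootedTree (TNode P x) (TArity P x) (TTri P x) r)
    × (2 ≤ PreOG.dim P x →
      (Σ (TNode P x) λ r → GammaCond P x (Σ.proj₁ r)
         × (∀ (r' : TNode P x) → GammaCond P x (Σ.proj₁ r') → r' ≡ r))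
      × (∀ (r : TNode P x) → GammaCond P x (Σ.proj₁ r) →
           IsRootedTree (TNode P x) (TArity P x) (TTri P x) r))
mainTheorem4 P D x 1≤dim =
  (λ dim≡1 r → isRootedTree x 1≤dim r (λ a₁ b _ → dim≡1⇒no-inputs x dim≡1 a₁ b)
                 (λ a → inj₂ (dim≡1⇒node-unique x dim≡1 a r))) ,
  (λ 2≤dim → γγ-root x 2≤dim ,
     λ r r-root → isRootedTree x 1≤dim r (γγ-root-orphan x r r-root)
                    (parent-or-γγ-root x 2≤dim r r-root))
  where open DendriticFaceComplex D
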